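{- Let $u\geq 0$ and $k\geq 2$ be integers. For integers $n\geq 2$ and $m\geq\max\{u,(k-1)(n-1)\}$ let $D(m,n,u,k)=\det(t_{ij})_{i,j=1,\ldots,n-1}$ with $t_{ij}=\binom{m-\max\{u,(k-1)j\}}{1-i+j}$. Then: (i) $D(m,n,u,k)=D(m-1,n,u,k)+D(m,n-1,u,k)$ for all integers $n\geq 3$ and $m\geq\max\{u+2,(k-1)(n-1)+1\}$; (ii) $D(m,2,u,k)=m-\max\{u,k-1\}$ for all integers $m\geq\max\{u+2,k\}$; (iii) if $u\geq k-1$, then $D(u+1,n,u,k)=1$ for all integers $n$ with $2\leq n\leq\lfloor\frac{u}{k-1}\rfloor+1$; (iv) $D((k-1)(n-1),n,u,k)=0$ for all integers $n\geq\max\{2,\lceil\frac{u}{k-1}\rceil+1\}$.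
   Context: For integers $N\geq 0$ and $r$, $\binom{N}{r}$ is the usual binomial coefficient, equal to $0$ if $r<0$ or $r>N$. The paper introduces $D(m,n,u,k)$ for $m\geq\max\{u+1,(k-1)(n-1)\}$; the same determinant formula (all upper arguments nonnegative) is used for the boundary values in (iv), where possibly $(k-1)(n-1)=u$. $\lfloor x\rfloor$ and $\lceil x\rceil$ denote floor and ceiling. -}

module Defs where

open import Data.Nat using (ℕ; zero; suc; _+_; _*_; _∸_; _⊔_; _≤_; _≤ᵇ_)
open import Data.Nat.DivMod using (_/_)
open import Data.Nat.Combinatorics using (_C_)
open import Data.Integer using (ℤ; +_; -[1+_]) renaming (_+_ to _+ℤ_; _*_ to _*ℤ_; -_ to -ℤ_)
open import Data.Fin using (Fin; zero; suc; toℕ; punchIn)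
open import Data.Bool using (if_then_else_)

-- Generalised binomial coefficient binom N r for N : ℕ, r : ℤ,
-- equal to 0 when r < 0 (and, via _C_, when r > N).
binom : ℕ → ℤ → ℕ
binom N (+ r)      = N C r
binom N -[1+ _ ]   = 0

sumℤ : ∀ n → (Fin n → ℤ) → ℤ
sumℤ zero    f = + 0
sumℤ (suc n) f = f zero +ℤ sumℤ n (λ j → f (suc j))

sign : ℕ → ℤ
sign zero          = + 1
sign (suc zero)    = -[1+ 0 ]
sign (suc (suc j)) = sign j

det : ∀ n → (Fin n → Fin n → ℤ) → ℤ
det zero    A = + 1
det (suc n) A = sumℤ (suc n) λ j →
  sign (toℕ j) *ℤ (A zero j *ℤ det n (λ i l → A (suc i) (punchIn j l)))

oneMinusPlus : ℕ → ℕ → ℤ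
oneMinusPlus i j = (+ 1 +ℤ -ℤ (+ i)) +ℤ (+ j)

-- Indices i,j ∈ {1,…,n-1} are represented by Fin (n ∸ 1) via toℕ + 1.
-- The upper argument uses truncated subtraction; in every use below it is
-- nonnegative (m ≥ max{u,(k-1)(n-1)}), so it agrees with the paper's integer.
D : ℕ → ℕ → ℕ → ℕ → ℤ
D m n u k = det (n ∸ 1) λ i j →
  + binom (m ∸ (u ⊔ ((k ∸ 1) * suc (toℕ j)))) (oneMinusPlus (suc (toℕ i)) (suc (toℕ j)))

-- floor(u/d) and ceil(u/d); only used with d = k-1 ≥ 1 (the d = 0 clause is a dummy).
floorDiv : ℕ → ℕ → ℕ
floorDiv u zero    = 0
floorDiv u (suc d) = u / suc d

ceilDiv : ℕ → ℕ → ℕ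
ceilDiv u zero    = 0
ceilDiv u (suc d) = (u + d) / suc d

module Submission where

-- The matrix t_ij = binom(m - c_j, 1 - i + j) is lower Hessenberg: zero
-- below the subdiagonal, ones on it.  The proof rests on the expansion of
-- a Hessenberg determinant along its LAST column,
--   det_{b+1} f = Σ_{i+t=b} (-1)^t f(i, i+t) det_i f     (det_i = leading i×i minor).
-- Defs expands along the first row; there every minor is block triangular,
-- hence the determinant of a shifted Hessenberg matrix, and an induction
-- that regroups a double anti-diagonal sum turns the first-row expansion
-- into the last-column one.  For t_ij the last column is binom(m - c_b, t+1):
--   (i)   Pascal's rule in that column, plus induction over leading minors;
--   (ii)  is the 1×1 case;
--   (iii) if every m - c_j = 1 only the diagonal entry survives, det_b = det_{b-1};
--   (iv)  if m - c_b = 0 the last column vanishes.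

open import Defs
open import Data.Nat using (ℕ; zero; suc; _+_; _*_; _∸_; _⊔_; _≤_; _<_; s≤s; z≤n)
import Data.Nat.Properties as ℕP
open import Data.Nat.DivMod using (_/_; m/n*n≤m; m≡m%n+[m/n]*n; m%n<n)
open import Data.Nat.Combinatorics using (_C_; nC1≡n; nCk+nC[k+1]≡[n+1]C[k+1])
open import Data.Nat.Combinatorics.Specification using (k>n⇒nCk≡0)
open import Data.Integer using (ℤ; +_; -[1+_]; _⊖_)
  renaming (_+_ to _+ℤ_; _*_ to _*ℤ_; -_ to -ℤ_)
import Data.Integer.Properties as ℤP
open import Data.Integer.Tactic.RingSolver using (solve-∀)
open import Data.Fin using (Fin; zero; suc; toℕ; punchIn)
open import Data.Product using (_×_; _,_)
open import Relation.Binary.PropositionalEquality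
open ≡-Reasoning

sumℕ : ℕ → (ℕ → ℤ) → ℤ
sumℕ zero    g = + 0
sumℕ (suc n) g = g 0 +ℤ sumℕ n (λ j → g (suc j))

sumℕ-zero : ∀ n g → (∀ j → g j ≡ + 0) → sumℕ n g ≡ + 0
sumℕ-zero zero    g g≡0 = refl
sumℕ-zero (suc n) g g≡0 = cong₂ _+ℤ_ (g≡0 0) (sumℕ-zero n _ (λ j → g≡0 (suc j)))

-- skip j l is the l-th index that remains once index j is deleted.
skip : ℕ → ℕ → ℕ
skip zero    l       = suc l
skip (suc j) zero    = zero
skip (suc j) (suc l) = suc (skip j l)

minor : ℕ → (ℕ → ℕ → ℤ) → ℕ → ℕ → ℤ
minor j f i l = f (suc i) (skip j l)

-- detℕ s f is the determinant of the leading s×s block of f, expanded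
-- along the first row exactly as det in Defs.
detℕ : ℕ → (ℕ → ℕ → ℤ) → ℤ
detℕ zero    f = + 1
detℕ (suc s) f = sumℕ (suc s) λ j → sign j *ℤ (f 0 j *ℤ detℕ s (minor j f))

toℕ-punchIn : ∀ {n} (j : Fin (suc n)) (l : Fin n) → toℕ (punchIn j l) ≡ skip (toℕ j) (toℕ l)
toℕ-punchIn zero    l       = refl
toℕ-punchIn (suc j) zero    = refl
toℕ-punchIn (suc j) (suc l) = cong suc (toℕ-punchIn j l)

sumℤ≡sumℕ : ∀ n (F : Fin n → ℤ) (g : ℕ → ℤ) → (∀ j → F j ≡ g (toℕ j)) → sumℤ n F ≡ sumℕ n g
sumℤ≡sumℕ zero    F g F≡g = refl
sumℤ≡sumℕ (suc n) F g F≡g =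
  cong₂ _+ℤ_ (F≡g zero) (sumℤ≡sumℕ n (λ j → F (suc j)) (λ j → g (suc j)) (λ j → F≡g (suc j)))

det≡detℕ : ∀ n (A : Fin n → Fin n → ℤ) (f : ℕ → ℕ → ℤ) →
  (∀ i j → A i j ≡ f (toℕ i) (toℕ j)) → det n A ≡ detℕ n f
det≡detℕ zero    A f A≡f = refl
det≡detℕ (suc n) A f A≡f = sumℤ≡sumℕ (suc n) _ (λ j → sign j *ℤ (f 0 j *ℤ detℕ n (minor j f))) λ j →
  cong₂ (λ a b → sign (toℕ j) *ℤ (a *ℤ b)) (A≡f zero j)
    (det≡detℕ n _ (minor (toℕ j) f) λ i l →
      trans (A≡f (suc i) (punchIn j l)) (cong (f (suc (toℕ i))) (toℕ-punchIn j l)))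

mutual
  det-zeroFirstColumn : ∀ s g → (∀ i → g i 0 ≡ + 0) → detℕ (suc s) g ≡ + 0
  det-zeroFirstColumn s g g₀≡0 = begin
    sign 0 *ℤ (g 0 0 *ℤ detℕ s (minor 0 g)) +ℤ tail  ≡⟨ cong (λ a → sign 0 *ℤ (a *ℤ detℕ s (minor 0 g)) +ℤ tail) (g₀≡0 0) ⟩
    + 0 +ℤ tail                                        ≡⟨ ℤP.+-identityˡ tail ⟩
    tail                                               ≡⟨ expansionTail-zero s (λ l → minor (suc l) g) (λ l → g 0 (suc l)) (λ l i → g₀≡0 (suc i)) ⟩
    + 0                                                ∎
    where
    tail : ℤ
    tail = sumℕ s (λ l → sign (suc l) *ℤ (g 0 (suc l) *ℤ detℕ s (minor (suc l) g)))

  expansionTail-zero : ∀ n (G : ℕ → ℕ → ℕ → ℤ) (a : ℕ → ℤ) → (∀ l i → G l i 0 ≡ + 0) →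
    sumℕ n (λ l → sign (suc l) *ℤ (a l *ℤ detℕ n (G l))) ≡ + 0
  expansionTail-zero zero    G a G₀≡0 = refl
  expansionTail-zero (suc n) G a G₀≡0 = sumℕ-zero (suc n) _ λ l → begin
    sign (suc l) *ℤ (a l *ℤ detℕ (suc n) (G l)) ≡⟨ cong (λ x → sign (suc l) *ℤ (a l *ℤ x)) (det-zeroFirstColumn n (G l) (G₀≡0 l)) ⟩
    sign (suc l) *ℤ (a l *ℤ + 0)                ≡⟨ times-zero (sign (suc l)) (a l) ⟩
    + 0                                         ∎
    where
    times-zero : ∀ x y → x *ℤ (y *ℤ + 0) ≡ + 0
    times-zero = solve-∀

-- Anti-diagonal sums:  antidiag N F = Σ_{p+q=N} F p q.
antidiag : ℕ → (ℕ → ℕ → ℤ) → ℤ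
antidiag zero    F = F 0 0
antidiag (suc N) F = F 0 (suc N) +ℤ antidiag N (λ p q → F (suc p) q)

sumℕ≡antidiag : ∀ b g (h : ℕ → ℕ → ℤ) → (∀ j r → j + r ≡ b → g j ≡ h j r) →
  sumℕ (suc b) g ≡ antidiag b h
sumℕ≡antidiag zero    g h g≡h = trans (ℤP.+-identityʳ _) (g≡h 0 0 refl)
sumℕ≡antidiag (suc b) g h g≡h =
  cong₂ _+ℤ_ (g≡h 0 (suc b) refl) (sumℕ≡antidiag b _ _ (λ j r e → g≡h (suc j) r (cong suc e)))

antidiag-cong : ∀ N F G → (∀ p q → p + q ≡ N → F p q ≡ G p q) → antidiag N F ≡ antidiag N G
antidiag-cong zero    F G F≡G = F≡G 0 0 refl
antidiag-cong (suc N) F G F≡G =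
  cong₂ _+ℤ_ (F≡G 0 (suc N) refl) (antidiag-cong N _ _ (λ p q e → F≡G (suc p) q (cong suc e)))

antidiag-zero : ∀ N F → (∀ p q → F p q ≡ + 0) → antidiag N F ≡ + 0
antidiag-zero zero    F F≡0 = F≡0 0 0
antidiag-zero (suc N) F F≡0 = cong₂ _+ℤ_ (F≡0 0 (suc N)) (antidiag-zero N _ (λ p q → F≡0 (suc p) q))

antidiag-+ : ∀ N F G → antidiag N (λ p q → F p q +ℤ G p q) ≡ antidiag N F +ℤ antidiag N G
antidiag-+ zero    F G = refl
antidiag-+ (suc N) F G = begin
  F₀ +ℤ G₀ +ℤ antidiag N (λ p q → F (suc p) q +ℤ G (suc p) q)
    ≡⟨ cong (F₀ +ℤ G₀ +ℤ_) (antidiag-+ N (λ p q → F (suc p) q) (λ p q → G (suc p) q)) ⟩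
  F₀ +ℤ G₀ +ℤ (antidiag N (λ p q → F (suc p) q) +ℤ antidiag N (λ p q → G (suc p) q))
    ≡⟨ interchange F₀ G₀ _ _ ⟩
  F₀ +ℤ antidiag N (λ p q → F (suc p) q) +ℤ (G₀ +ℤ antidiag N (λ p q → G (suc p) q))
    ∎
  where
  F₀ G₀ : ℤ
  F₀ = F 0 (suc N)
  G₀ = G 0 (suc N)
  interchange : ∀ a b c d → (a +ℤ b) +ℤ (c +ℤ d) ≡ (a +ℤ c) +ℤ (b +ℤ d)
  interchange = solve-∀

antidiag-scale : ∀ N a F → a *ℤ antidiag N F ≡ antidiag N (λ p q → a *ℤ F p q)
antidiag-scale zero    a F = refl
antidiag-scale (suc N) a F =
  trans (ℤP.*-distribˡ-+ a _ _) (cong (a *ℤ F 0 (suc N) +ℤ_) (antidiag-scale N a _))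

antidiag-last : ∀ N F → antidiag (suc N) F ≡ antidiag N (λ p q → F p (suc q)) +ℤ F (suc N) 0
antidiag-last zero    F = refl
antidiag-last (suc N) F = trans
  (cong (F 0 (suc (suc N)) +ℤ_) (antidiag-last N (λ p q → F (suc p) q)))
  (sym (ℤP.+-assoc (F 0 (suc (suc N))) _ (F (suc (suc N)) 0)))

-- Σ_{j+x=N} Σ_{i+t=x} F j i t  =  Σ_{y+t=N} Σ_{j+i=y} F j i t
-- (both sides sum F over all j + i + t = N).
antidiag-regroup : ∀ N (F : ℕ → ℕ → ℕ → ℤ) →
  antidiag N (λ j x → antidiag x (λ i t → F j i t)) ≡ antidiag N (λ y t → antidiag y (λ j i → F j i t))
antidiag-regroup zero    F = refl
antidiag-regroup (suc N) F = begin
  F 0 0 (suc N) +ℤ first +ℤ rest                ≡⟨ ℤP.+-assoc (F 0 0 (suc N)) first rest ⟩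
  F 0 0 (suc N) +ℤ (first +ℤ rest)              ≡⟨ cong (λ z → F 0 0 (suc N) +ℤ (first +ℤ z)) (antidiag-regroup N (λ j → F (suc j))) ⟩
  F 0 0 (suc N) +ℤ (first +ℤ rest′)             ≡⟨ cong (F 0 0 (suc N) +ℤ_) (sym (antidiag-+ N _ _)) ⟩
  F 0 0 (suc N) +ℤ antidiag N (λ y t → F 0 (suc y) t +ℤ antidiag y (λ j i → F (suc j) i t)) ∎
  where
  first rest rest′ : ℤ
  first = antidiag N (λ i t → F 0 (suc i) t)
  rest  = antidiag N (λ j x → antidiag x (λ i t → F (suc j) i t))
  rest′ = antidiag N (λ y t → antidiag y (λ j i → F (suc j) i t))

record Hessenberg (f : ℕ → ℕ → ℤ) : Set where
  field
    below-subdiagonal : ∀ l d → f (suc (suc (l + d))) l ≡ + 0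
    on-subdiagonal    : ∀ l → f (suc l) l ≡ + 1
open Hessenberg

shift : ℕ → (ℕ → ℕ → ℤ) → ℕ → ℕ → ℤ
shift a f i l = f (a + i) (a + l)

shift-Hessenberg : ∀ a f → Hessenberg f → Hessenberg (shift a f)
shift-Hessenberg a f H = record
  { below-subdiagonal = λ l d → trans (cong (λ x → f x (a + l)) (reindex l d)) (below-subdiagonal H (a + l) d)
  ; on-subdiagonal    = λ l → trans (cong (λ x → f x (a + l)) (ℕP.+-suc a l)) (on-subdiagonal H (a + l))
  }
  where
  reindex : ∀ l d → a + suc (suc (l + d)) ≡ suc (suc (a + l + d))
  reindex l d = trans (ℕP.+-suc a _) (cong suc (trans (ℕP.+-suc a _) (cong suc (sym (ℕP.+-assoc a l d)))))

-- Deleting row 0 and column j of a Hessenberg matrix leaves a block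
-- triangular matrix: a unitriangular j×j block, then the shifted matrix.
det-minor : ∀ j r f → Hessenberg f → detℕ (j + r) (minor j f) ≡ detℕ r (shift (suc j) f)
det-minor zero    r f H = refl
det-minor (suc j) r f H = begin
  sign 0 *ℤ (f 1 0 *ℤ detℕ (j + r) (minor 0 (minor (suc j) f))) +ℤ tail
    ≡⟨ cong₂ (λ a b → sign 0 *ℤ (a *ℤ b) +ℤ tail) (on-subdiagonal H 0)
             (det-minor j r (shift 1 f) (shift-Hessenberg 1 f H)) ⟩
  sign 0 *ℤ (+ 1 *ℤ detℕ r (shift (suc (suc j)) f)) +ℤ tail
    ≡⟨ cong (sign 0 *ℤ (+ 1 *ℤ detℕ r (shift (suc (suc j)) f)) +ℤ_)
            (expansionTail-zero (j + r) (λ l → minor (suc l) (minor (suc j) f)) (λ l → minor (suc j) f 0 (suc l)) (λ l i → below-subdiagonal H 0 i)) ⟩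
  sign 0 *ℤ (+ 1 *ℤ detℕ r (shift (suc (suc j)) f)) +ℤ + 0
    ≡⟨ unit (detℕ r (shift (suc (suc j)) f)) ⟩
  detℕ r (shift (suc (suc j)) f) ∎
  where
  tail : ℤ
  tail = sumℕ (j + r) (λ l → sign (suc l) *ℤ (minor (suc j) f 0 (suc l) *ℤ detℕ (j + r) (minor (suc l) (minor (suc j) f))))
  unit : ∀ x → + 1 *ℤ (+ 1 *ℤ x) +ℤ + 0 ≡ x
  unit = solve-∀

firstRowTerm : (ℕ → ℕ → ℤ) → ℕ → ℕ → ℤ
firstRowTerm f j r = sign j *ℤ (f 0 j *ℤ detℕ r (shift (suc j) f))

det-firstRow : ∀ s f → Hessenberg f → detℕ (suc s) f ≡ antidiag s (firstRowTerm f)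
det-firstRow s f H = sumℕ≡antidiag s _ (firstRowTerm f) λ j r e →
  cong (λ x → sign j *ℤ (f 0 j *ℤ x))
    (trans (cong (λ n → detℕ n (minor j f)) (sym e)) (det-minor j r f H))

lastColumnTerm : (ℕ → ℕ → ℤ) → ℕ → ℕ → ℤ
lastColumnTerm f i t = sign t *ℤ (f i (i + t) *ℤ detℕ i f)

lastColumnExpansion : (ℕ → ℕ → ℤ) → ℕ → ℤ
lastColumnExpansion f b = antidiag b (lastColumnTerm f)

mixedTerm : (ℕ → ℕ → ℤ) → ℕ → ℕ → ℕ → ℤ
mixedTerm f j i t = sign j *ℤ (f 0 j *ℤ lastColumnTerm (shift (suc j) f) i t)

-- Collecting the mixed terms with a fixed t recovers a first-row expansion
-- of det_{y+1} f, hence one last-column term of f.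
mixedTerms-collect : ∀ y t f → Hessenberg f →
  antidiag y (λ j i → mixedTerm f j i t) ≡ lastColumnTerm f (suc y) t
mixedTerms-collect y t f H = begin
  antidiag y (λ j i → mixedTerm f j i t)
    ≡⟨ antidiag-cong y _ _ (λ j i e → trans (swap (sign j) (f 0 j) (sign t) (shift (suc j) f i (i + t)) (detℕ i (shift (suc j) f)))
         (cong (λ z → sign t *ℤ (z *ℤ firstRowTerm f j i)) (entry j i e))) ⟩
  antidiag y (λ j i → sign t *ℤ (a *ℤ firstRowTerm f j i))
    ≡⟨ sym (antidiag-scale y (sign t) _) ⟩
  sign t *ℤ antidiag y (λ j i → a *ℤ firstRowTerm f j i)
    ≡⟨ cong (sign t *ℤ_) (sym (antidiag-scale y a _)) ⟩
  sign t *ℤ (a *ℤ antidiag y (firstRowTerm f))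
    ≡⟨ cong (λ z → sign t *ℤ (a *ℤ z)) (sym (det-firstRow y f H)) ⟩
  lastColumnTerm f (suc y) t ∎
  where
  a : ℤ
  a = f (suc y) (suc y + t)
  swap : ∀ sj b st c d → sj *ℤ (b *ℤ (st *ℤ (c *ℤ d))) ≡ st *ℤ (c *ℤ (sj *ℤ (b *ℤ d)))
  swap = solve-∀
  entry : ∀ j i → j + i ≡ y → shift (suc j) f i (i + t) ≡ a
  entry j i e = cong₂ f (cong suc e) (cong suc (trans (sym (ℕP.+-assoc j i t)) (cong (_+ t) e)))

-- Induction on a bound N for the size; the shifted minors met in the
-- first-row expansion are smaller, but arbitrary Hessenberg matrices.
det-lastColumn≤ : ∀ N b → b ≤ N → ∀ f → Hessenberg f → detℕ (suc b) f ≡ lastColumnExpansion f b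
det-lastColumn≤ N       zero    _          f H = ℤP.+-identityʳ _
det-lastColumn≤ (suc N) (suc b) (s≤s b≤N) f H = begin
  detℕ (suc (suc b)) f
    ≡⟨ det-firstRow (suc b) f H ⟩
  antidiag (suc b) (firstRowTerm f)
    ≡⟨ antidiag-last b (firstRowTerm f) ⟩
  antidiag b (λ j q → firstRowTerm f j (suc q)) +ℤ firstRowTerm f (suc b) 0
    ≡⟨ cong (_+ℤ firstRowTerm f (suc b) 0) (antidiag-cong b _ _ expandMinor) ⟩
  antidiag b (λ j x → antidiag x (λ i t → mixedTerm f j i t)) +ℤ firstRowTerm f (suc b) 0
    ≡⟨ cong (_+ℤ firstRowTerm f (suc b) 0) (antidiag-regroup b (mixedTerm f)) ⟩
  antidiag b (λ y t → antidiag y (λ j i → mixedTerm f j i t)) +ℤ firstRowTerm f (suc b) 0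
    ≡⟨ cong (_+ℤ firstRowTerm f (suc b) 0) (antidiag-cong b _ _ (λ y t _ → mixedTerms-collect y t f H)) ⟩
  antidiag b (λ y t → lastColumnTerm f (suc y) t) +ℤ lastColumnTerm f 0 (suc b)
    ≡⟨ ℤP.+-comm (antidiag b (λ y t → lastColumnTerm f (suc y) t)) (lastColumnTerm f 0 (suc b)) ⟩
  lastColumnExpansion f (suc b) ∎
  where
  expandMinor : ∀ j q → j + q ≡ b → firstRowTerm f j (suc q) ≡ antidiag q (mixedTerm f j)
  expandMinor j q e = begin
    sign j *ℤ (f 0 j *ℤ detℕ (suc q) (shift (suc j) f))
      ≡⟨ cong (λ z → sign j *ℤ (f 0 j *ℤ z))
           (det-lastColumn≤ N q (ℕP.≤-trans (subst (q ≤_) e (ℕP.m≤n+m q j)) b≤N)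
             (shift (suc j) f) (shift-Hessenberg (suc j) f H)) ⟩
    sign j *ℤ (f 0 j *ℤ lastColumnExpansion (shift (suc j) f) q)
      ≡⟨ cong (sign j *ℤ_) (antidiag-scale q (f 0 j) _) ⟩
    sign j *ℤ antidiag q (λ i t → f 0 j *ℤ lastColumnTerm (shift (suc j) f) i t)
      ≡⟨ antidiag-scale q (sign j) _ ⟩
    antidiag q (mixedTerm f j) ∎

det-lastColumn : ∀ b f → Hessenberg f → detℕ (suc b) f ≡ lastColumnExpansion f b
det-lastColumn b = det-lastColumn≤ b b ℕP.≤-refl

-- The paper's matrix with 0-based indices and column offsets c:
-- binomMatrix c m i l = binom(m - c_l, 1 - (i+1) + (l+1)).
binomMatrix : (ℕ → ℕ) → ℕ → ℕ → ℕ → ℤ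
binomMatrix c m i l = + binom (m ∸ c l) (oneMinusPlus (suc i) (suc l))

oneMinusPlus-suc : ∀ i l → oneMinusPlus (suc i) (suc l) ≡ suc l ⊖ i
oneMinusPlus-suc i l =
  trans (cong (_+ℤ + suc l) (ℤP.[1+m]⊖[1+n]≡m⊖n 0 i)) (ℤP.distribˡ-⊖-+-pos (suc l) 0 i)

-- Below the subdiagonal the lower argument is negative; on it, it is 0.
binomMatrix-Hessenberg : ∀ c m → Hessenberg (binomMatrix c m)
binomMatrix-Hessenberg c m = record
  { below-subdiagonal = λ l d → cong (λ z → + binom (m ∸ c l) z) (negative l d)
  ; on-subdiagonal    = λ l → cong (λ z → + binom (m ∸ c l) z)
                          (trans (oneMinusPlus-suc (suc l) l) (ℤP.n⊖n≡0 (suc l)))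
  }
  where
  negative : ∀ l d → oneMinusPlus (suc (suc (suc (l + d)))) (suc l) ≡ -[1+ d ]
  negative l d = begin
    oneMinusPlus (suc (suc (suc (l + d)))) (suc l) ≡⟨ oneMinusPlus-suc (suc (suc (l + d))) l ⟩
    suc l ⊖ suc (suc (l + d))                      ≡⟨ ℤP.[1+m]⊖[1+n]≡m⊖n l (suc (l + d)) ⟩
    l ⊖ suc (l + d)                                ≡⟨ ℤP.⊖-< (s≤s (ℕP.m≤m+n l d)) ⟩
    -ℤ (+ (suc (l + d) ∸ l))                       ≡⟨ cong (λ z → -ℤ (+ z)) (trans (cong (_∸ l) (sym (ℕP.+-suc l d))) (ℕP.m+n∸m≡n l (suc d))) ⟩
    -[1+ d ] ∎

binomMatrix-entry : ∀ c m i t → binomMatrix c m i (i + t) ≡ + ((m ∸ c (i + t)) C suc t)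
binomMatrix-entry c m i t = cong (λ z → + binom (m ∸ c (i + t)) z) (begin
  oneMinusPlus (suc i) (suc (i + t)) ≡⟨ oneMinusPlus-suc i (i + t) ⟩
  suc (i + t) ⊖ i                    ≡⟨ ℤP.⊖-≥ (ℕP.m≤n⇒m≤1+n (ℕP.m≤m+n i t)) ⟩
  + (suc (i + t) ∸ i)                ≡⟨ cong +_ (trans (cong (_∸ i) (sym (ℕP.+-suc i t))) (ℕP.m+n∸m≡n i (suc t))) ⟩
  + suc t ∎)

binomMatrix-lastColumn : ∀ c m b →
  detℕ (suc b) (binomMatrix c m) ≡ antidiag b (λ i t → sign t *ℤ (+ ((m ∸ c b) C suc t) *ℤ detℕ i (binomMatrix c m)))
binomMatrix-lastColumn c m b = trans (det-lastColumn b _ (binomMatrix-Hessenberg c m))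
  (antidiag-cong b _ _ λ i t e → cong (λ z → sign t *ℤ (z *ℤ detℕ i (binomMatrix c m)))
    (trans (binomMatrix-entry c m i t) (cong (λ y → + ((m ∸ c y) C suc t)) e)))

sign-suc : ∀ q → sign (suc q) ≡ -ℤ sign q
sign-suc zero    = refl
sign-suc (suc q) = trans (sym (ℤP.neg-involutive (sign q))) (cong -ℤ_ (sym (sign-suc q)))

previous : (ℕ → ℤ) → ℕ → ℤ
previous A zero    = + 0
previous A (suc i) = A i

alternating-telescope : ∀ b x (A : ℕ → ℤ) →
  antidiag b (λ i t → sign t *ℤ (+ (x C suc t) *ℤ previous A i)) +ℤ
  antidiag b (λ i t → sign t *ℤ (+ (x C t) *ℤ A i)) ≡ A b
alternating-telescope zero x A = base (+ (x C 1)) (A 0)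
  where
  base : ∀ c a → + 1 *ℤ (c *ℤ + 0) +ℤ + 1 *ℤ (+ 1 *ℤ a) ≡ a
  base = solve-∀
alternating-telescope (suc b) x A = begin
  antidiag (suc b) Up +ℤ antidiag (suc b) Down
    ≡⟨ cong (antidiag (suc b) Up +ℤ_) (antidiag-last b Down) ⟩
  (Up 0 (suc b) +ℤ antidiag b Same) +ℤ (antidiag b Opposite +ℤ Down (suc b) 0)
    ≡⟨ reassoc (Up 0 (suc b)) _ _ _ ⟩
  (Up 0 (suc b) +ℤ (antidiag b Same +ℤ antidiag b Opposite)) +ℤ Down (suc b) 0
    ≡⟨ cong₂ (λ a z → (a +ℤ z) +ℤ Down (suc b) 0)
         (times-zero (sign (suc b)) (+ (x C suc (suc b))))
         (trans (sym (antidiag-+ b Same Opposite)) (antidiag-zero b _ cancel)) ⟩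
  + 0 +ℤ + 0 +ℤ Down (suc b) 0
    ≡⟨ unit (A (suc b)) ⟩
  A (suc b) ∎
  where
  Up Down Same Opposite : ℕ → ℕ → ℤ
  Up i t       = sign t *ℤ (+ (x C suc t) *ℤ previous A i)
  Down i t     = sign t *ℤ (+ (x C t) *ℤ A i)
  Same p q     = sign q *ℤ (+ (x C suc q) *ℤ A p)
  Opposite p q = sign (suc q) *ℤ (+ (x C suc q) *ℤ A p)
  reassoc : ∀ z X Y w → (z +ℤ X) +ℤ (Y +ℤ w) ≡ (z +ℤ (X +ℤ Y)) +ℤ w
  reassoc = solve-∀
  times-zero : ∀ s c → s *ℤ (c *ℤ + 0) ≡ + 0
  times-zero = solve-∀
  unit : ∀ a → + 0 +ℤ + 0 +ℤ + 1 *ℤ (+ 1 *ℤ a) ≡ a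
  unit = solve-∀
  opposite-signs : ∀ s c a → s *ℤ (c *ℤ a) +ℤ (-ℤ s) *ℤ (c *ℤ a) ≡ + 0
  opposite-signs = solve-∀
  cancel : ∀ p q → Same p q +ℤ Opposite p q ≡ + 0
  cancel p q = trans (cong (λ s → Same p q +ℤ s *ℤ (+ (x C suc q) *ℤ A p)) (sign-suc q))
                     (opposite-signs (sign q) (+ (x C suc q)) (A p))

-- Pascal's rule applied to the last column, for one size b + 1, given the
-- recurrence for all smaller leading minors.
pascal-step : ∀ c m b → suc (c b) ≤ m →
  (∀ i → i ≤ b → detℕ i (binomMatrix c m) ≡ detℕ i (binomMatrix c (m ∸ 1)) +ℤ previous (λ i → detℕ i (binomMatrix c m)) i) →
  detℕ (suc b) (binomMatrix c m) ≡ detℕ (suc b) (binomMatrix c (m ∸ 1)) +ℤ detℕ b (binomMatrix c m)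
pascal-step c m b fits IH = begin
  detℕ (suc b) (binomMatrix c m)
    ≡⟨ binomMatrix-lastColumn c m b ⟩
  antidiag b (λ i t → sign t *ℤ (+ ((m ∸ c b) C suc t) *ℤ A i))
    ≡⟨ antidiag-cong b _ _ split ⟩
  antidiag b (λ i t → Low i t +ℤ (Up i t +ℤ Down i t))
    ≡⟨ antidiag-+ b Low _ ⟩
  antidiag b Low +ℤ antidiag b (λ i t → Up i t +ℤ Down i t)
    ≡⟨ cong₂ _+ℤ_ (sym lowered) (trans (antidiag-+ b Up Down) (alternating-telescope b x A)) ⟩
  detℕ (suc b) (binomMatrix c (m ∸ 1)) +ℤ A b ∎
  where
  A B : ℕ → ℤ
  A i = detℕ i (binomMatrix c m)
  B i = detℕ i (binomMatrix c (m ∸ 1))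
  x : ℕ
  x = m ∸ suc (c b)
  Low Up Down : ℕ → ℕ → ℤ
  Low i t  = sign t *ℤ (+ (x C suc t) *ℤ B i)
  Up i t   = sign t *ℤ (+ (x C suc t) *ℤ previous A i)
  Down i t = sign t *ℤ (+ (x C t) *ℤ A i)
  ∸-suc : ∀ p q → suc q ≤ p → p ∸ q ≡ suc (p ∸ suc q)
  ∸-suc (suc p) zero    _         = refl
  ∸-suc (suc p) (suc q) (s≤s q<p) = ∸-suc p q q<p
  lowered : B (suc b) ≡ antidiag b Low
  lowered = trans (binomMatrix-lastColumn c (m ∸ 1) b) (antidiag-cong b _ _ λ i t _ →
    cong (λ z → sign t *ℤ (+ (z C suc t) *ℤ B i)) (ℕP.∸-+-assoc m 1 (c b)))
  separate : ∀ s c₀ c₁ a → s *ℤ ((c₀ +ℤ c₁) *ℤ a) ≡ s *ℤ (c₁ *ℤ a) +ℤ s *ℤ (c₀ *ℤ a)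
  separate = solve-∀
  distribute : ∀ s c b k w → s *ℤ (c *ℤ (b +ℤ k)) +ℤ w ≡ s *ℤ (c *ℤ b) +ℤ (s *ℤ (c *ℤ k) +ℤ w)
  distribute = solve-∀
  split : ∀ i t → i + t ≡ b → sign t *ℤ (+ ((m ∸ c b) C suc t) *ℤ A i) ≡ Low i t +ℤ (Up i t +ℤ Down i t)
  split i t e = begin
    sign t *ℤ (+ ((m ∸ c b) C suc t) *ℤ A i)
      ≡⟨ cong (λ z → sign t *ℤ (+ (z C suc t) *ℤ A i)) (∸-suc m (c b) fits) ⟩
    sign t *ℤ (+ (suc x C suc t) *ℤ A i)
      ≡⟨ cong (λ z → sign t *ℤ (+ z *ℤ A i)) (sym (nCk+nC[k+1]≡[n+1]C[k+1] x t)) ⟩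
    sign t *ℤ ((+ (x C t) +ℤ + (x C suc t)) *ℤ A i)
      ≡⟨ separate (sign t) (+ (x C t)) (+ (x C suc t)) (A i) ⟩
    sign t *ℤ (+ (x C suc t) *ℤ A i) +ℤ Down i t
      ≡⟨ cong (λ z → sign t *ℤ (+ (x C suc t) *ℤ z) +ℤ Down i t) (IH i (subst (i ≤_) e (ℕP.m≤m+n i t))) ⟩
    sign t *ℤ (+ (x C suc t) *ℤ (B i +ℤ previous A i)) +ℤ Down i t
      ≡⟨ distribute (sign t) (+ (x C suc t)) (B i) (previous A i) (Down i t) ⟩
    Low i t +ℤ (Up i t +ℤ Down i t) ∎

binomMatrix-pascal≤ : ∀ c m N → (∀ j → j < N → suc (c j) ≤ m) → ∀ b → b ≤ N →
  detℕ b (binomMatrix c m) ≡ detℕ b (binomMatrix c (m ∸ 1)) +ℤ previous (λ i → detℕ i (binomMatrix c m)) b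
binomMatrix-pascal≤ c m N       fits zero    _         = refl
binomMatrix-pascal≤ c m (suc N) fits (suc b) (s≤s b≤N) =
  pascal-step c m b (fits b (s≤s b≤N)) λ i i≤b →
    binomMatrix-pascal≤ c m N (λ j j<N → fits j (ℕP.m<n⇒m<1+n j<N)) i (ℕP.≤-trans i≤b b≤N)

binomMatrix-pascal : ∀ c m b → (∀ j → j < suc b → suc (c j) ≤ m) →
  detℕ (suc b) (binomMatrix c m) ≡ detℕ (suc b) (binomMatrix c (m ∸ 1)) +ℤ detℕ b (binomMatrix c m)
binomMatrix-pascal c m b fits = binomMatrix-pascal≤ c m (suc b) fits (suc b) ℕP.≤-refl

-- With binom(1, t+1) in the last column only the diagonal entry survives.
lastColumn-ones : ∀ b (A : ℕ → ℤ) → antidiag b (λ i t → sign t *ℤ (+ (1 C suc t) *ℤ A i)) ≡ A b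
lastColumn-ones zero    A = unit (A 0)
  where
  unit : ∀ a → + 1 *ℤ (+ 1 *ℤ a) ≡ a
  unit = solve-∀
lastColumn-ones (suc b) A = begin
  antidiag (suc b) Term                           ≡⟨ antidiag-last b Term ⟩
  antidiag b (λ i t → Term i (suc t)) +ℤ Term (suc b) 0
    ≡⟨ cong (_+ℤ Term (suc b) 0) (antidiag-zero b _ λ i t → trans
         (cong (λ z → sign (suc t) *ℤ (+ z *ℤ A i)) (k>n⇒nCk≡0 {1} {suc (suc t)} (s≤s (s≤s z≤n))))
         (ℤP.*-zeroʳ (sign (suc t)))) ⟩
  + 0 +ℤ Term (suc b) 0                           ≡⟨ unit (A (suc b)) ⟩
  A (suc b) ∎
  where
  Term : ℕ → ℕ → ℤ
  Term i t = sign t *ℤ (+ (1 C suc t) *ℤ A i)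
  unit : ∀ a → + 0 +ℤ + 1 *ℤ (+ 1 *ℤ a) ≡ a
  unit = solve-∀

binomMatrix-unitColumns : ∀ c m b → (∀ j → j < b → m ∸ c j ≡ 1) → detℕ b (binomMatrix c m) ≡ + 1
binomMatrix-unitColumns c m zero    ones = refl
binomMatrix-unitColumns c m (suc b) ones = begin
  detℕ (suc b) (binomMatrix c m)
    ≡⟨ binomMatrix-lastColumn c m b ⟩
  antidiag b (λ i t → sign t *ℤ (+ ((m ∸ c b) C suc t) *ℤ detℕ i (binomMatrix c m)))
    ≡⟨ antidiag-cong b _ _ (λ i t _ → cong (λ z → sign t *ℤ (+ (z C suc t) *ℤ detℕ i (binomMatrix c m)))
         (ones b (ℕP.n<1+n b))) ⟩
  antidiag b (λ i t → sign t *ℤ (+ (1 C suc t) *ℤ detℕ i (binomMatrix c m)))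
    ≡⟨ lastColumn-ones b (λ i → detℕ i (binomMatrix c m)) ⟩
  detℕ b (binomMatrix c m)
    ≡⟨ binomMatrix-unitColumns c m b (λ j j<b → ones j (ℕP.m<n⇒m<1+n j<b)) ⟩
  + 1 ∎

-- If m - c_b = 0 the last column binom(0, t+1) vanishes.
binomMatrix-zeroLastColumn : ∀ c m b → m ∸ c b ≡ 0 → detℕ (suc b) (binomMatrix c m) ≡ + 0
binomMatrix-zeroLastColumn c m b m-cb≡0 = trans (binomMatrix-lastColumn c m b) (antidiag-zero b _ λ i t →
  trans (cong (λ z → sign t *ℤ (+ z *ℤ detℕ i (binomMatrix c m)))
               (trans (cong (_C suc t) m-cb≡0) (k>n⇒nCk≡0 {0} {suc t} (s≤s z≤n))))
        (ℤP.*-zeroʳ (sign t)))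

-- Column j (0-based) of the paper's matrix has upper argument m - offset j.
offset : ℕ → ℕ → ℕ → ℕ
offset u d j = u ⊔ (suc d * suc j)

D≡detℕ : ∀ u d m n → D m n u (2 + d) ≡ detℕ (n ∸ 1) (binomMatrix (offset u d) m)
D≡detℕ u d m n = det≡detℕ (n ∸ 1) _ (binomMatrix (offset u d) m) (λ i j → refl)

below-floor : ∀ u d j → j < u / suc d → suc d * suc j ≤ u
below-floor u d j j<q = ℕP.≤-trans (ℕP.*-monoʳ-≤ (suc d) j<q)
  (ℕP.≤-trans (ℕP.≤-reflexive (ℕP.*-comm (suc d) (u / suc d))) (m/n*n≤m u (suc d)))

-- u ≤ (k-1) q once q ≥ ceil(u/(k-1)) = (u + k - 2)/(k-1); here u + d is
-- written as remainder + quotient·(d+1) with remainder ≤ d.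
above-ceil : ∀ u d q → (u + d) / suc d ≤ q → u ≤ suc d * q
above-ceil u d q ceil≤q = ℕP.≤-trans u≤ceil*
  (ℕP.≤-trans (ℕP.*-monoˡ-≤ (suc d) ceil≤q) (ℕP.≤-reflexive (ℕP.*-comm q (suc d))))
  where
  u≤ceil* : u ≤ (u + d) / suc d * suc d
  u≤ceil* = ℕP.+-cancelˡ-≤ d u _ (ℕP.≤-trans
    (ℕP.≤-reflexive (trans (ℕP.+-comm d u) (m≡m%n+[m/n]*n (u + d) (suc d))))
    (ℕP.+-monoˡ-≤ _ (ℕP.≤-pred (m%n<n (u + d) (suc d)))))

D-pascal : ∀ u d n m → 3 ≤ n → (u + 2) ⊔ (suc d * (n ∸ 1) + 1) ≤ m →
  D m n u (2 + d) ≡ D (m ∸ 1) n u (2 + d) +ℤ D m (n ∸ 1) u (2 + d)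
D-pascal u d (suc (suc (suc b))) m (s≤s (s≤s (s≤s _))) m≥ = begin
  D m (3 + b) u (2 + d)
    ≡⟨ D≡detℕ u d m (3 + b) ⟩
  detℕ (suc (suc b)) (binomMatrix (offset u d) m)
    ≡⟨ binomMatrix-pascal (offset u d) m (suc b) columnsFit ⟩
  detℕ (suc (suc b)) (binomMatrix (offset u d) (m ∸ 1)) +ℤ detℕ (suc b) (binomMatrix (offset u d) m)
    ≡⟨ sym (cong₂ _+ℤ_ (D≡detℕ u d (m ∸ 1) (3 + b)) (D≡detℕ u d m (2 + b))) ⟩
  D (m ∸ 1) (3 + b) u (2 + d) +ℤ D m (2 + b) u (2 + d) ∎
  where
  columnsFit : ∀ j → j < suc (suc b) → suc (offset u d j) ≤ m
  columnsFit j j<b+2 = ℕP.⊔-lub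
    (ℕP.≤-trans (ℕP.≤-trans (ℕP.n≤1+n (suc u)) (ℕP.≤-reflexive (ℕP.+-comm 2 u))) (ℕP.≤-trans (ℕP.m≤m⊔n _ _) m≥))
    (ℕP.≤-trans (ℕP.≤-trans (s≤s (ℕP.*-monoʳ-≤ (suc d) j<b+2)) (ℕP.≤-reflexive (ℕP.+-comm 1 _)))
                (ℕP.≤-trans (ℕP.m≤n⊔m _ _) m≥))

-- Part (ii): the 1×1 determinant binom(m - max{u, k-1}, 1).
D-two : ∀ u d m → D m 2 u (2 + d) ≡ + (m ∸ (u ⊔ suc d))
D-two u d m = begin
  + 1 *ℤ (+ (x C 1) *ℤ + 1) +ℤ + 0 ≡⟨ unit (+ (x C 1)) ⟩
  + (x C 1)                       ≡⟨ cong +_ (nC1≡n x) ⟩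
  + x                             ≡⟨ cong (λ z → + (m ∸ (u ⊔ z))) (ℕP.*-identityʳ (suc d)) ⟩
  + (m ∸ (u ⊔ suc d)) ∎
  where
  x : ℕ
  x = m ∸ (u ⊔ suc d * 1)
  unit : ∀ a → + 1 *ℤ (a *ℤ + 1) +ℤ + 0 ≡ a
  unit = solve-∀

-- Part (iii): for n ≤ floor(u/(k-1)) + 1 every column has offset u.
D-one : ∀ u d n → n ≤ u / suc d + 1 → D (u + 1) n u (2 + d) ≡ + 1
D-one u d n n≤ = trans (D≡detℕ u d (u + 1) n) (binomMatrix-unitColumns (offset u d) (u + 1) (n ∸ 1) λ j j< →
  trans (cong (u + 1 ∸_) (ℕP.m≥n⇒m⊔n≡m (below-floor u d j (ℕP.<-≤-trans j< n-1≤q)))) (ℕP.m+n∸m≡n u 1))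
  where
  n-1≤q : n ∸ 1 ≤ u / suc d
  n-1≤q = ℕP.≤-trans (ℕP.∸-monoˡ-≤ 1 n≤) (ℕP.≤-reflexive (ℕP.m+n∸n≡m (u / suc d) 1))

-- Part (iv): at m = (k-1)(n-1) ≥ u the last column has offset m.
D-zero : ∀ u d n → 2 ≤ n → (u + d) / suc d + 1 ≤ n → D (suc d * (n ∸ 1)) n u (2 + d) ≡ + 0
D-zero u d (suc (suc b)) (s≤s (s≤s _)) ceil< = trans (D≡detℕ u d M (2 + b))
  (binomMatrix-zeroLastColumn (offset u d) M b
    (trans (cong (M ∸_) (ℕP.m≤n⇒m⊔n≡n (above-ceil u d (suc b) ceil≤))) (ℕP.n∸n≡0 M)))
  where
  M : ℕ
  M = suc d * suc b
  ceil≤ : (u + d) / suc d ≤ suc b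
  ceil≤ = ℕP.≤-pred (ℕP.≤-trans (ℕP.≤-reflexive (ℕP.+-comm 1 _)) ceil<)

lemma3p2 : (u k : ℕ) → 2 ≤ k →
    ((n m : ℕ) → 3 ≤ n → (u + 2) ⊔ ((k ∸ 1) * (n ∸ 1) + 1) ≤ m →
       D m n u k ≡ D (m ∸ 1) n u k +ℤ D m (n ∸ 1) u k)
    × ((m : ℕ) → (u + 2) ⊔ k ≤ m → D m 2 u k ≡ + (m ∸ (u ⊔ (k ∸ 1))))
    × (k ∸ 1 ≤ u → (n : ℕ) → 2 ≤ n → n ≤ floorDiv u (k ∸ 1) + 1 → D (u + 1) n u k ≡ + 1)
    × ((n : ℕ) → 2 ⊔ (ceilDiv u (k ∸ 1) + 1) ≤ n → D ((k ∸ 1) * (n ∸ 1)) n u k ≡ + 0)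
lemma3p2 u (suc (suc d)) (s≤s (s≤s _)) =
    D-pascal u d
  , (λ m _ → D-two u d m)
  , (λ _ n _ → D-one u d n)
  , (λ n n≥ → D-zero u d n (ℕP.≤-trans (ℕP.m≤m⊔n 2 ceil+1) n≥) (ℕP.≤-trans (ℕP.m≤n⊔m 2 ceil+1) n≥))
  where
  ceil+1 : ℕ
  ceil+1 = (u + d) / suc d + 1
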